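{- Let $k\ge2$ be an integer and let $(a_n)_{n\ge0}$, $(b_n)_{n\ge0}$ be given by $a_0=1$, $a_1=k+1$, $b_0=1$, $b_1=2$ and, for $n\ge2$, $a_n=2a_{n-1}+(k-1)a_{n-2}$, $b_n=2b_{n-1}+(k-1)b_{n-2}$. Then for all $n\ge0$: $$a_{2n}=\frac{2k a_n}{k-1}\sqrt{\frac{a_n^2-(1-k)^{n+1}}{k}}-\frac{2a_n^2}{k-1}-(1-k)^n,$$ $$b_{2n}=\frac{(1-k)^{n+1}+2k b_n^2-2b_n\sqrt{k b_n^2+(1-k)^{n+1}}}{k-1}.$$ Consequently, for all $n\ge0$, $$a_{2^{n+1}}=\frac{2k a_{2^n}}{k-1}\sqrt{\frac{a_{2^n}^2-(1-k)^{2^n+1}}{k}}-\frac{2a_{2^n}^2}{k-1}-(1-k)^{2^n},\quad b_{2^{n+1}}=\frac{(1-k)^{2^n+1}+2k b_{2^n}^2-2b_{2^n}\sqrt{k b_{2^n}^2+(1-k)^{2^n+1}}}{k-1}.$$ -}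

module Defs where

open import Data.Nat using (ℕ; zero; suc)
open import Data.Integer using (ℤ; +_)
import Data.Integer as ℤ
open import Data.Rational using (ℚ; _/_)

a : ℕ → ℕ → ℤ
a k zero = + 1
a k (suc zero) = + (suc k)
a k (suc (suc n)) = (+ 2) ℤ.* a k (suc n) ℤ.+ (+ k ℤ.- + 1) ℤ.* a k n

b : ℕ → ℕ → ℤ
b k zero = + 1
b k (suc zero) = + 2
b k (suc (suc n)) = (+ 2) ℤ.* b k (suc n) ℤ.+ (+ k ℤ.- + 1) ℤ.* b k n

oneMinus : ℕ → ℤ
oneMinus k = + 1 ℤ.- + k

ι : ℤ → ℚ
ι z = z / 1

-- Since 1 + √k is a root of t² = 2t + (k - 1), the sequences satisfy a (n+1) = a n + k b n and
-- b (n+1) = a n + b n, i.e. a n + b n √k = (1 + √k)^(n+1).  Taking norms gives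
-- a n² - k b n² = (1 - k)^(n+1), and squaring gives a (2n) + k b (2n) = a n² + k b n² and
-- a (2n) + b (2n) = 2 a n b n.  Solving this linear system for a (2n), b (2n) and using the norm
-- identity yields both formulas, the square roots being the nonnegative integers b n and a n.
module Submission where

open import Defs
open import Data.Nat using (ℕ; zero; suc)
import Data.Nat as ℕ
import Data.Nat.Properties as ℕ
open import Data.Integer as ℤ using (+_; 0ℤ; 1ℤ; +≤+)
import Data.Integer.Properties as ℤ
open import Data.Integer.Tactic.RingSolver using (solve-∀)
open import Data.Rational as ℚ using (ℚ; 0ℚ)
import Data.Rational.Properties as ℚ
open import Data.Rational.Unnormalised as ℚᵘ using (mkℚᵘ; *≡*)
import Data.Rational.Unnormalised.Properties as ℚᵘ
open import Data.Product using (Σ; _×_; _,_)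
open import Relation.Binary.PropositionalEquality

0≤+m*i : ∀ m {i} → 0ℤ ℤ.≤ i → 0ℤ ℤ.≤ + m ℤ.* i
0≤+m*i m (+≤+ {n = i} _) = subst (0ℤ ℤ.≤_) (ℤ.pos-* m i) (+≤+ ℕ.z≤n)

module _ (k : ℕ) where
  open import Data.Integer using (_+_; _-_; _*_; _^_; _≤_)
  open ≡-Reasoning

  mutual
    a-suc : ∀ n → a k (suc n) ≡ a k n + + k * b k n
    a-suc zero = cong (_+_ 1ℤ) (sym (ℤ.*-identityʳ (+ k)))
    a-suc (suc n) = begin
      + 2 * a k (suc n) + (+ k - + 1) * a k n
        ≡⟨ cong (λ x → + 2 * x + (+ k - + 1) * a k n) (a-suc n) ⟩
      + 2 * (a k n + + k * b k n) + (+ k - + 1) * a k n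
        ≡⟨ step (a k n) (b k n) (+ k) ⟩
      (a k n + + k * b k n) + + k * (a k n + b k n)
        ≡⟨ cong₂ (λ x y → x + + k * y) (a-suc n) (b-suc n) ⟨
      a k (suc n) + + k * b k (suc n) ∎
      where
      step : ∀ x y c → + 2 * (x + c * y) + (c - + 1) * x ≡ (x + c * y) + c * (x + y)
      step = solve-∀

    b-suc : ∀ n → b k (suc n) ≡ a k n + b k n
    b-suc zero = refl
    b-suc (suc n) = begin
      + 2 * b k (suc n) + (+ k - + 1) * b k n
        ≡⟨ cong (λ y → + 2 * y + (+ k - + 1) * b k n) (b-suc n) ⟩
      + 2 * (a k n + b k n) + (+ k - + 1) * b k n
        ≡⟨ step (a k n) (b k n) (+ k) ⟩
      (a k n + + k * b k n) + (a k n + b k n)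
        ≡⟨ cong₂ _+_ (a-suc n) (b-suc n) ⟨
      a k (suc n) + b k (suc n) ∎
      where
      step : ∀ x y c → + 2 * (x + y) + (c - + 1) * y ≡ (x + c * y) + (x + y)
      step = solve-∀

  -- The solver does not know ℤ._^_: a square x ^ 2 is spelled x * (x * 1ℤ), to which it unfolds.
  a²-kb² : ∀ n → a k n ^ 2 - + k * b k n ^ 2 ≡ oneMinus k ^ suc n
  a²-kb² zero = base (+ k)
    where
    base : ∀ c → 1ℤ * (1ℤ * 1ℤ) - c * (1ℤ * (1ℤ * 1ℤ)) ≡ (1ℤ - c) * 1ℤ
    base = solve-∀
  a²-kb² (suc n) = begin
    a k (suc n) ^ 2 - + k * b k (suc n) ^ 2
      ≡⟨ cong₂ (λ x y → x ^ 2 - + k * y ^ 2) (a-suc n) (b-suc n) ⟩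
    (a k n + + k * b k n) ^ 2 - + k * (a k n + b k n) ^ 2
      ≡⟨ step (a k n) (b k n) (+ k) ⟩
    oneMinus k * (a k n ^ 2 - + k * b k n ^ 2)
      ≡⟨ cong (oneMinus k *_) (a²-kb² n) ⟩
    oneMinus k ^ suc (suc n) ∎
    where
    step : ∀ x y c → (x + c * y) * ((x + c * y) * 1ℤ) - c * ((x + y) * ((x + y) * 1ℤ))
                   ≡ (1ℤ - c) * (x * (x * 1ℤ) - c * (y * (y * 1ℤ)))
    step = solve-∀

  mutual
    a-suc-+ : ∀ m n → a k (suc (m ℕ.+ n)) ≡ a k m * a k n + + k * (b k m * b k n)
    a-suc-+ zero n = trans (a-suc n) (base (a k n) (b k n) (+ k))
      where
      base : ∀ x y c → x + c * y ≡ 1ℤ * x + c * (1ℤ * y)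
      base = solve-∀
    a-suc-+ (suc m) n = begin
      a k (suc (suc m ℕ.+ n))
        ≡⟨ a-suc (suc (m ℕ.+ n)) ⟩
      a k (suc (m ℕ.+ n)) + + k * b k (suc (m ℕ.+ n))
        ≡⟨ cong₂ (λ x y → x + + k * y) (a-suc-+ m n) (b-suc-+ m n) ⟩
      (a k m * a k n + + k * (b k m * b k n)) + + k * (a k m * b k n + b k m * a k n)
        ≡⟨ step (a k m) (b k m) (a k n) (b k n) (+ k) ⟩
      (a k m + + k * b k m) * a k n + + k * ((a k m + b k m) * b k n)
        ≡⟨ cong₂ (λ x y → x * a k n + + k * (y * b k n)) (a-suc m) (b-suc m) ⟨
      a k (suc m) * a k n + + k * (b k (suc m) * b k n) ∎
      where
      step : ∀ x y x′ y′ c → (x * x′ + c * (y * y′)) + c * (x * y′ + y * x′)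
                           ≡ (x + c * y) * x′ + c * ((x + y) * y′)
      step = solve-∀

    b-suc-+ : ∀ m n → b k (suc (m ℕ.+ n)) ≡ a k m * b k n + b k m * a k n
    b-suc-+ zero n = trans (b-suc n) (base (a k n) (b k n))
      where
      base : ∀ x y → x + y ≡ 1ℤ * y + 1ℤ * x
      base = solve-∀
    b-suc-+ (suc m) n = begin
      b k (suc (suc m ℕ.+ n))
        ≡⟨ b-suc (suc (m ℕ.+ n)) ⟩
      a k (suc (m ℕ.+ n)) + b k (suc (m ℕ.+ n))
        ≡⟨ cong₂ _+_ (a-suc-+ m n) (b-suc-+ m n) ⟩
      (a k m * a k n + + k * (b k m * b k n)) + (a k m * b k n + b k m * a k n)
        ≡⟨ step (a k m) (b k m) (a k n) (b k n) (+ k) ⟩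
      (a k m + + k * b k m) * b k n + (a k m + b k m) * a k n
        ≡⟨ cong₂ (λ x y → x * b k n + y * a k n) (a-suc m) (b-suc m) ⟨
      a k (suc m) * b k n + b k (suc m) * a k n ∎
      where
      step : ∀ x y x′ y′ c → (x * x′ + c * (y * y′)) + (x * y′ + y * x′)
                           ≡ (x + c * y) * y′ + (x + y) * x′
      step = solve-∀

  a-suc-2* : ∀ n → a k (suc (2 ℕ.* n)) ≡ a k n * a k n + + k * (b k n * b k n)
  a-suc-2* n = trans (cong (λ j → a k (suc (n ℕ.+ j))) (ℕ.+-identityʳ n)) (a-suc-+ n n)

  b-suc-2* : ∀ n → b k (suc (2 ℕ.* n)) ≡ a k n * b k n + b k n * a k n
  b-suc-2* n = trans (cong (λ j → b k (suc (n ℕ.+ j))) (ℕ.+-identityʳ n)) (b-suc-+ n n)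

  a-double : ∀ n → (+ k - + 1) * a k (2 ℕ.* n)
               ≡ + 2 * + k * a k n * b k n - + 2 * a k n ^ 2 - (+ k - + 1) * oneMinus k ^ n
  a-double n = begin
    (+ k - + 1) * a k (2 ℕ.* n)
      ≡⟨ eliminate (a k (2 ℕ.* n)) (b k (2 ℕ.* n)) (+ k) ⟩
    + k * (a k (2 ℕ.* n) + b k (2 ℕ.* n)) - (a k (2 ℕ.* n) + + k * b k (2 ℕ.* n))
      ≡⟨ cong₂ (λ u v → + k * u - v) (b-suc (2 ℕ.* n)) (a-suc (2 ℕ.* n)) ⟨
    + k * b k (suc (2 ℕ.* n)) - a k (suc (2 ℕ.* n))
      ≡⟨ cong₂ (λ u v → + k * u - v) (b-suc-2* n) (a-suc-2* n) ⟩
    + k * (A * B + B * A) - (A * A + + k * (B * B))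
      ≡⟨ regroup A B (+ k) ⟩
    + 2 * + k * A * B - + 2 * A ^ 2 + (A ^ 2 - + k * B ^ 2)
      ≡⟨ cong (λ p → + 2 * + k * A * B - + 2 * A ^ 2 + p) (a²-kb² n) ⟩
    + 2 * + k * A * B - + 2 * A ^ 2 + oneMinus k ^ suc n
      ≡⟨ flip-sign (+ 2 * + k * A * B - + 2 * A ^ 2) (+ k) (oneMinus k ^ n) ⟩
    + 2 * + k * A * B - + 2 * A ^ 2 - (+ k - + 1) * oneMinus k ^ n ∎
    where
    A = a k n
    B = b k n
    eliminate : ∀ s t c → (c - 1ℤ) * s ≡ c * (s + t) - (s + c * t)
    eliminate = solve-∀
    regroup : ∀ x y c → c * (x * y + y * x) - (x * x + c * (y * y))
                      ≡ + 2 * c * x * y - + 2 * (x * (x * 1ℤ)) + (x * (x * 1ℤ) - c * (y * (y * 1ℤ)))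
    regroup = solve-∀
    flip-sign : ∀ x c p → x + (1ℤ - c) * p ≡ x - (c - 1ℤ) * p
    flip-sign = solve-∀

  b-double : ∀ n → (+ k - + 1) * b k (2 ℕ.* n)
               ≡ oneMinus k ^ suc n + + 2 * + k * b k n ^ 2 - + 2 * b k n * a k n
  b-double n = begin
    (+ k - + 1) * b k (2 ℕ.* n)
      ≡⟨ eliminate (a k (2 ℕ.* n)) (b k (2 ℕ.* n)) (+ k) ⟩
    (a k (2 ℕ.* n) + + k * b k (2 ℕ.* n)) - (a k (2 ℕ.* n) + b k (2 ℕ.* n))
      ≡⟨ cong₂ _-_ (a-suc (2 ℕ.* n)) (b-suc (2 ℕ.* n)) ⟨
    a k (suc (2 ℕ.* n)) - b k (suc (2 ℕ.* n))
      ≡⟨ cong₂ _-_ (a-suc-2* n) (b-suc-2* n) ⟩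
    (A * A + + k * (B * B)) - (A * B + B * A)
      ≡⟨ regroup A B (+ k) ⟩
    (A ^ 2 - + k * B ^ 2) + + 2 * + k * B ^ 2 - + 2 * B * A
      ≡⟨ cong (λ p → p + + 2 * + k * B ^ 2 - + 2 * B * A) (a²-kb² n) ⟩
    oneMinus k ^ suc n + + 2 * + k * B ^ 2 - + 2 * B * A ∎
    where
    A = a k n
    B = b k n
    eliminate : ∀ s t c → (c - 1ℤ) * t ≡ (s + c * t) - (s + t)
    eliminate = solve-∀
    regroup : ∀ x y c → (x * x + c * (y * y)) - (x * y + y * x)
                      ≡ (x * (x * 1ℤ) - c * (y * (y * 1ℤ))) + + 2 * c * (y * (y * 1ℤ)) - + 2 * y * x
    regroup = solve-∀

  mutual
    0≤a : ∀ n → 0ℤ ≤ a k n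
    0≤a zero = +≤+ ℕ.z≤n
    0≤a (suc n) = subst (0ℤ ≤_) (sym (a-suc n)) (ℤ.+-mono-≤ (0≤a n) (0≤+m*i k (0≤b n)))

    0≤b : ∀ n → 0ℤ ≤ b k n
    0≤b zero = +≤+ ℕ.z≤n
    0≤b (suc n) = subst (0ℤ ≤_) (sym (b-suc n)) (ℤ.+-mono-≤ (0≤a n) (0≤b n))

open import Data.Rational using (_+_; _-_; _*_; -_)

-- ι z is by definition fromℚᵘ (mkℚᵘ z 0).
toℚᵘ-ι : ∀ z → ℚ.toℚᵘ (ι z) ℚᵘ.≃ mkℚᵘ z 0
toℚᵘ-ι z = ℚ.toℚᵘ-fromℚᵘ (mkℚᵘ z 0)

ι-homo-+ : ∀ x y → ι (x ℤ.+ y) ≡ ι x + ι y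
ι-homo-+ x y = ℚ.toℚᵘ-injective (begin
  ℚ.toℚᵘ (ι (x ℤ.+ y))                 ≈⟨ toℚᵘ-ι (x ℤ.+ y) ⟩
  mkℚᵘ (x ℤ.+ y) 0                      ≈⟨ *≡* (clear-denominators x y) ⟩
  mkℚᵘ x 0 ℚᵘ.+ mkℚᵘ y 0                ≈⟨ ℚᵘ.+-cong (toℚᵘ-ι x) (toℚᵘ-ι y) ⟨
  ℚ.toℚᵘ (ι x) ℚᵘ.+ ℚ.toℚᵘ (ι y)        ≈⟨ ℚ.toℚᵘ-homo-+ (ι x) (ι y) ⟨
  ℚ.toℚᵘ (ι x + ι y)                    ∎)
  where
  open ℚᵘ.≃-Reasoning
  clear-denominators : ∀ x y → (x ℤ.+ y) ℤ.* 1ℤ ≡ (x ℤ.* 1ℤ ℤ.+ y ℤ.* 1ℤ) ℤ.* 1ℤ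
  clear-denominators = solve-∀

ι-homo-* : ∀ x y → ι (x ℤ.* y) ≡ ι x * ι y
ι-homo-* x y = ℚ.toℚᵘ-injective (begin
  ℚ.toℚᵘ (ι (x ℤ.* y))                 ≈⟨ toℚᵘ-ι (x ℤ.* y) ⟩
  mkℚᵘ x 0 ℚᵘ.* mkℚᵘ y 0                ≈⟨ ℚᵘ.*-cong (toℚᵘ-ι x) (toℚᵘ-ι y) ⟨
  ℚ.toℚᵘ (ι x) ℚᵘ.* ℚ.toℚᵘ (ι y)        ≈⟨ ℚ.toℚᵘ-homo-* (ι x) (ι y) ⟨
  ℚ.toℚᵘ (ι x * ι y)                    ∎)
  where open ℚᵘ.≃-Reasoning

ι-homo-‿- : ∀ x → ι (ℤ.- x) ≡ - ι x
ι-homo-‿- x = ℚ.toℚᵘ-injective (begin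
  ℚ.toℚᵘ (ι (ℤ.- x))     ≈⟨ toℚᵘ-ι (ℤ.- x) ⟩
  mkℚᵘ (ℤ.- x) 0         ≈⟨ ℚᵘ.-‿cong (toℚᵘ-ι x) ⟨
  ℚᵘ.- ℚ.toℚᵘ (ι x)      ≈⟨ ℚ.toℚᵘ-homo‿- (ι x) ⟨
  ℚ.toℚᵘ (- ι x)         ∎)
  where open ℚᵘ.≃-Reasoning

ι-homo-- : ∀ x y → ι (x ℤ.- y) ≡ ι x - ι y
ι-homo-- x y = trans (ι-homo-+ x (ℤ.- y)) (cong (_+_ (ι x)) (ι-homo-‿- y))

ι-homo-*² : ∀ x y z → ι (x ℤ.* y ℤ.* z) ≡ ι x * ι y * ι z
ι-homo-*² x y z = trans (ι-homo-* (x ℤ.* y) z) (cong (_* ι z) (ι-homo-* x y))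

ι-homo-*³ : ∀ x y z w → ι (x ℤ.* y ℤ.* z ℤ.* w) ≡ ι x * ι y * ι z * ι w
ι-homo-*³ x y z w = trans (ι-homo-* (x ℤ.* y ℤ.* z) w) (cong (_* ι w) (ι-homo-*² x y z))

ι-nonNeg : ∀ {z} → 0ℤ ℤ.≤ z → 0ℚ ℚ.≤ ι z
ι-nonNeg (+≤+ {n = m} _) = ℚ.nonNegative⁻¹ (ι (+ m)) {{ℚ.normalize-nonNeg m 1}}

open import Data.Nat using (_≤_; _^_)

-- e stands for the exponent n + 1, which the second half of the theorem spells 2 ^ n + 1.
DoublingFormulas : ℕ → ℕ → ℕ → Set
DoublingFormulas k n e =
      (Σ ℚ λ y → (0ℚ ℚ.≤ y) × (ι (+ k) * (y * y) ≡ ι (a k n ℤ.^ 2) - ι (oneMinus k ℤ.^ e))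
        × (ι (+ k ℤ.- + 1) * ι (a k (2 ℕ.* n)) ≡ ι (+ 2) * ι (+ k) * ι (a k n) * y - ι (+ 2) * ι (a k n ℤ.^ 2) - ι (+ k ℤ.- + 1) * ι (oneMinus k ℤ.^ n)))
      × (Σ ℚ λ y → (0ℚ ℚ.≤ y) × (y * y ≡ ι (+ k) * ι (b k n ℤ.^ 2) + ι (oneMinus k ℤ.^ e))
        × (ι (+ k ℤ.- + 1) * ι (b k (2 ℕ.* n)) ≡ ι (oneMinus k ℤ.^ e) + ι (+ 2) * ι (+ k) * ι (b k n ℤ.^ 2) - ι (+ 2) * ι (b k n) * y))

doublingFormulas : ∀ k n → DoublingFormulas k n (suc n)
doublingFormulas k n =
    (ι B , ι-nonNeg (0≤b k n) , k·B²≡A²-P , a-formula)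
  , (ι A , ι-nonNeg (0≤a k n) , A²≡k·B²+P , b-formula)
  where
  open ≡-Reasoning
  A = a k n
  B = b k n
  K = + k
  K-1 = + k ℤ.- + 1
  P = oneMinus k ℤ.^ suc n

  k·B²≡A²-P : ι K * (ι B * ι B) ≡ ι (A ℤ.^ 2) - ι P
  k·B²≡A²-P = begin
    ι K * (ι B * ι B)                          ≡⟨ cong (ι K *_) (ι-homo-* B B) ⟨
    ι K * ι (B ℤ.* B)                          ≡⟨ ι-homo-* K (B ℤ.* B) ⟨
    ι (K ℤ.* (B ℤ.* B))                        ≡⟨ cong ι (rearrange A B K) ⟩
    ι (A ℤ.^ 2 ℤ.- (A ℤ.^ 2 ℤ.- K ℤ.* B ℤ.^ 2)) ≡⟨ cong (λ p → ι (A ℤ.^ 2 ℤ.- p)) (a²-kb² k n) ⟩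
    ι (A ℤ.^ 2 ℤ.- P)                          ≡⟨ ι-homo-- (A ℤ.^ 2) P ⟩
    ι (A ℤ.^ 2) - ι P                          ∎
    where
    rearrange : ∀ x y c → c ℤ.* (y ℤ.* y) ≡ x ℤ.* (x ℤ.* 1ℤ) ℤ.- (x ℤ.* (x ℤ.* 1ℤ) ℤ.- c ℤ.* (y ℤ.* (y ℤ.* 1ℤ)))
    rearrange = solve-∀

  A²≡k·B²+P : ι A * ι A ≡ ι K * ι (B ℤ.^ 2) + ι P
  A²≡k·B²+P = begin
    ι A * ι A                                  ≡⟨ ι-homo-* A A ⟨
    ι (A ℤ.* A)                                ≡⟨ cong ι (rearrange A B K) ⟩
    ι (K ℤ.* B ℤ.^ 2 ℤ.+ (A ℤ.^ 2 ℤ.- K ℤ.* B ℤ.^ 2)) ≡⟨ cong (λ p → ι (K ℤ.* B ℤ.^ 2 ℤ.+ p)) (a²-kb² k n) ⟩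
    ι (K ℤ.* B ℤ.^ 2 ℤ.+ P)                    ≡⟨ ι-homo-+ (K ℤ.* B ℤ.^ 2) P ⟩
    ι (K ℤ.* B ℤ.^ 2) + ι P                    ≡⟨ cong (_+ ι P) (ι-homo-* K (B ℤ.^ 2)) ⟩
    ι K * ι (B ℤ.^ 2) + ι P                    ∎
    where
    rearrange : ∀ x y c → x ℤ.* x ≡ c ℤ.* (y ℤ.* (y ℤ.* 1ℤ)) ℤ.+ (x ℤ.* (x ℤ.* 1ℤ) ℤ.- c ℤ.* (y ℤ.* (y ℤ.* 1ℤ)))
    rearrange = solve-∀

  a-formula : ι K-1 * ι (a k (2 ℕ.* n))
             ≡ ι (+ 2) * ι K * ι A * ι B - ι (+ 2) * ι (A ℤ.^ 2) - ι K-1 * ι (oneMinus k ℤ.^ n)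
  a-formula = begin
    ι K-1 * ι (a k (2 ℕ.* n))              ≡⟨ ι-homo-* K-1 (a k (2 ℕ.* n)) ⟨
    ι (K-1 ℤ.* a k (2 ℕ.* n))              ≡⟨ cong ι (a-double k n) ⟩
    ι (X ℤ.- Y ℤ.- Z)                      ≡⟨ ι-homo-- (X ℤ.- Y) Z ⟩
    ι (X ℤ.- Y) - ι Z                      ≡⟨ cong₂ _-_ (ι-homo-- X Y) (ι-homo-* K-1 (oneMinus k ℤ.^ n)) ⟩
    ι X - ι Y - ι K-1 * ι (oneMinus k ℤ.^ n) ≡⟨ cong₂ (λ u v → u - v - ι K-1 * ι (oneMinus k ℤ.^ n))
                                                   (ι-homo-*³ (+ 2) K A B) (ι-homo-* (+ 2) (A ℤ.^ 2)) ⟩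
    ι (+ 2) * ι K * ι A * ι B - ι (+ 2) * ι (A ℤ.^ 2) - ι K-1 * ι (oneMinus k ℤ.^ n) ∎
    where
    X = + 2 ℤ.* K ℤ.* A ℤ.* B
    Y = + 2 ℤ.* A ℤ.^ 2
    Z = K-1 ℤ.* oneMinus k ℤ.^ n

  b-formula : ι K-1 * ι (b k (2 ℕ.* n)) ≡ ι P + ι (+ 2) * ι K * ι (B ℤ.^ 2) - ι (+ 2) * ι B * ι A
  b-formula = begin
    ι K-1 * ι (b k (2 ℕ.* n))              ≡⟨ ι-homo-* K-1 (b k (2 ℕ.* n)) ⟨
    ι (K-1 ℤ.* b k (2 ℕ.* n))              ≡⟨ cong ι (b-double k n) ⟩
    ι (P ℤ.+ X ℤ.- Y)                      ≡⟨ ι-homo-- (P ℤ.+ X) Y ⟩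
    ι (P ℤ.+ X) - ι Y                      ≡⟨ cong (_- ι Y) (ι-homo-+ P X) ⟩
    ι P + ι X - ι Y                        ≡⟨ cong₂ (λ u v → ι P + u - v) (ι-homo-*² (+ 2) K (B ℤ.^ 2)) (ι-homo-*² (+ 2) B A) ⟩
    ι P + ι (+ 2) * ι K * ι (B ℤ.^ 2) - ι (+ 2) * ι B * ι A ∎
    where
    X = + 2 ℤ.* K ℤ.* B ℤ.^ 2
    Y = + 2 ℤ.* B ℤ.* A

-- The formulas are stated multiplied through by k and k - 1, so they hold for every k;
-- 2 ≤ k is only needed to divide by them.
mainTheorem11 : (k : ℕ) → 2 ≤ k →
    ((n : ℕ) →
      (Σ ℚ λ y → (0ℚ ℚ.≤ y) × (ι (+ k) * (y * y) ≡ ι (a k n ℤ.^ 2) - ι (oneMinus k ℤ.^ suc n))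
        × (ι (+ k ℤ.- + 1) * ι (a k (2 ℕ.* n)) ≡ ι (+ 2) * ι (+ k) * ι (a k n) * y - ι (+ 2) * ι (a k n ℤ.^ 2) - ι (+ k ℤ.- + 1) * ι (oneMinus k ℤ.^ n)))
      × (Σ ℚ λ y → (0ℚ ℚ.≤ y) × (y * y ≡ ι (+ k) * ι (b k n ℤ.^ 2) + ι (oneMinus k ℤ.^ suc n))
        × (ι (+ k ℤ.- + 1) * ι (b k (2 ℕ.* n)) ≡ ι (oneMinus k ℤ.^ suc n) + ι (+ 2) * ι (+ k) * ι (b k n ℤ.^ 2) - ι (+ 2) * ι (b k n) * y)))
    × ((n : ℕ) →
      (Σ ℚ λ y → (0ℚ ℚ.≤ y) × (ι (+ k) * (y * y) ≡ ι (a k (2 ^ n) ℤ.^ 2) - ι (oneMinus k ℤ.^ (2 ^ n ℕ.+ 1)))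
        × (ι (+ k ℤ.- + 1) * ι (a k (2 ^ suc n)) ≡ ι (+ 2) * ι (+ k) * ι (a k (2 ^ n)) * y - ι (+ 2) * ι (a k (2 ^ n) ℤ.^ 2) - ι (+ k ℤ.- + 1) * ι (oneMinus k ℤ.^ (2 ^ n))))
      × (Σ ℚ λ y → (0ℚ ℚ.≤ y) × (y * y ≡ ι (+ k) * ι (b k (2 ^ n) ℤ.^ 2) + ι (oneMinus k ℤ.^ (2 ^ n ℕ.+ 1)))
        × (ι (+ k ℤ.- + 1) * ι (b k (2 ^ suc n)) ≡ ι (oneMinus k ℤ.^ (2 ^ n ℕ.+ 1)) + ι (+ 2) * ι (+ k) * ι (b k (2 ^ n) ℤ.^ 2) - ι (+ 2) * ι (b k (2 ^ n)) * y)))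
mainTheorem11 k _ =
  doublingFormulas k , λ n → subst (DoublingFormulas k (2 ^ n)) (ℕ.+-comm 1 (2 ^ n)) (doublingFormulas k (2 ^ n))
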